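{- The poset $(\Omega,\leq_S)$ is graded, and the rank of $\omega\in\Omega$ is $n-|\omega|$, where $|\omega|$ is the number of blocks of $\omega$.
   Context: A pre-order on $[n]$ is a reflexive transitive relation $\preceq$; blocks are classes of $i\equiv j\iff i\preceq j\preceq i$. Blocks $B,B'$ overlap if $[\min B,\max B]\cap[\min B',\max B']\ne\emptyset$. $\Omega$ is the set of permutation pre-orders on $[n]$: pre-orders in which (P1) overlapping blocks are comparable and (P2) every covering relation between blocks is between overlapping blocks. The order $\le_S$ on $\Omega$ is containment of relations: $\omega\le_S\omega'$ iff every relation $i\preceq j$ holding in $\omega$ also holds in $\omega'$. (This poset is isomorphic to the shard intersection order of the braid arrangement, i.e., shard intersections ordered by reverse containment.) -}

module Defs where

open import Data.Nat using (ℕ; zero; suc; _∸_; _<ᵇ_)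
open import Data.Fin using (Fin; toℕ; _≤_)
open import Data.Bool using (Bool; true; false; _∧_; not)
open import Data.List using (length; allFin; filterᵇ)
open import Data.Bool.ListAction using (any)
open import Data.Product using (_×_; Σ; ∃₂; proj₁)
open import Data.Sum using (_⊎_)
open import Relation.Nullary using (¬_)
open import Relation.Binary.PropositionalEquality using (_≡_)

BRel : ℕ → Set
BRel n = Fin n → Fin n → Bool

_∶_⪯_ : ∀ {n} → BRel n → Fin n → Fin n → Set
R ∶ i ⪯ j = R i j ≡ true

IsPreorder : ∀ {n} → BRel n → Set
IsPreorder {n} R = (∀ (i : Fin n) → R ∶ i ⪯ i)
                 × (∀ (i j k : Fin n) → R ∶ i ⪯ j → R ∶ j ⪯ k → R ∶ i ⪯ k)

SameBlock : ∀ {n} → BRel n → Fin n → Fin n → Set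
SameBlock R i j = R ∶ i ⪯ j × R ∶ j ⪯ i

-- The blocks [i] and [j] overlap: [min [i], max [i]] ∩ [min [j], max [j]] ≠ ∅,
-- i.e. min [i] ≤ max [j] and min [j] ≤ max [i].
Overlap : ∀ {n} → BRel n → Fin n → Fin n → Set
Overlap R i j =
  (∃₂ λ a d → SameBlock R a i × SameBlock R d j × a ≤ d)
  × (∃₂ λ c b → SameBlock R c j × SameBlock R b i × c ≤ b)

Comparable : ∀ {n} → BRel n → Fin n → Fin n → Set
Comparable R i j = R ∶ i ⪯ j ⊎ R ∶ j ⪯ i

BlockLt : ∀ {n} → BRel n → Fin n → Fin n → Set
BlockLt R i j = R ∶ i ⪯ j × ¬ (R ∶ j ⪯ i)

BlockCover : ∀ {n} → BRel n → Fin n → Fin n → Set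
BlockCover {n} R i j = BlockLt R i j × (∀ (k : Fin n) → ¬ (BlockLt R i k × BlockLt R k j))

IsPermPreorder : ∀ {n} → BRel n → Set
IsPermPreorder {n} R =
  IsPreorder R
  × (∀ (i j : Fin n) → Overlap R i j → Comparable R i j)
  × (∀ (i j : Fin n) → BlockCover R i j → Overlap R i j)

Ω : ℕ → Set
Ω n = Σ (BRel n) IsPermPreorder

_≤S_ : ∀ {n} → Ω n → Ω n → Set
_≤S_ {n} ω ω' = ∀ (i j : Fin n) → proj₁ ω ∶ i ⪯ j → proj₁ ω' ∶ i ⪯ j

-- number of blocks |ω|: each block is counted via its least element,
-- i.e. the number of i such that no j < i lies in the same block as i.
isBlockMin : ∀ {n} → BRel n → Fin n → Bool
isBlockMin {n} R i = not (any (λ j → (toℕ j <ᵇ toℕ i) ∧ R i j ∧ R j i) (allFin n))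

numBlocks : ∀ {n} → Ω n → ℕ
numBlocks {n} ω = length (filterᵇ (isBlockMin (proj₁ ω)) (allFin n))

module _ {A : Set} (_≼_ : A → A → Set) where
  StrictLt : A → A → Set
  StrictLt x y = x ≼ y × ¬ (y ≼ x)

  Covers : A → A → Set
  Covers x y = StrictLt x y × (∀ z → ¬ (StrictLt x z × StrictLt z y))

  Minimal : A → Set
  Minimal x = ∀ y → ¬ StrictLt y x

  IsGradedBy : (A → ℕ) → Set
  IsGradedBy ρ = (∀ x → Minimal x → ρ x ≡ 0)
               × (∀ x y → Covers x y → ρ y ≡ suc (ρ x))

module Submission where

-- Minimal elements.  The discrete order (i ⪯ j iff i = j) lies in Ω and below every
-- ω, so a minimal ω is discrete and has n blocks, i.e. rank 0.
--
-- Covers ω ⋖ ω', with relations R ⊆ R'.  We show |ω| = |ω'| + 1.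
--  * Rigidity: if R and R' have the same blocks then R' ⊆ R, since every strict
--    relation of R' is a chain of block covers, each between overlapping blocks
--    (P2), which R must compare (P1) in the right direction.  Hence some block of
--    ω' contains two blocks of ω, and |ω'| < |ω|.
--  * One merge: there is ζ ∈ Ω with ω <S ζ ≤S ω' and |ω| ≤ |ζ| + 1, obtained by
--    fusing two blocks X, Y of ω inside one block of ω'.  As ω ⋖ ω', ζ has the
--    blocks of ω', so |ω| ≤ |ω'| + 1.  The general merge construction adds
--    down × up to R, for a down-set `down` and an up-set `up` with down ∩ up = X ∪ Y;
--    it gives a pre-order with at most one block less than R, for which P1 and P2
--    only need checking at the fused block.  X and Y are either the two sides of a
--    block cover of ω (case A) or two ω-incomparable blocks (case B).

open import Defs
open import Data.Nat using (ℕ; zero; suc; _+_; _∸_; _≤_; _<_; z≤n; s≤s; _<ᵇ_)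
import Data.Nat.Properties as ℕₚ
open import Data.Nat.Properties using (≤-refl; ≤-trans; <-irrefl; <-trans; <-≤-trans; <ᵇ⇒<; <⇒<ᵇ; +-suc; +-comm)
open import Data.Fin using (Fin; toℕ; _≟_) renaming (zero to fzero; suc to fsuc)
open import Data.Fin.Properties using (toℕ-injective; any?; all?)
open import Data.Bool using (Bool; true; false; _∧_; _∨_; not; T)
open import Data.Bool.Properties using () renaming (_≟_ to _≟ᵇ_)
open import Data.List using (List; []; _∷_; length; filterᵇ; allFin)
open import Data.Bool.ListAction using (any)
open import Data.List.Membership.Propositional using (_∈_)
open import Data.List.Membership.Propositional.Properties using (∈-allFin)
open import Data.List.Relation.Unary.Any using (here; there)
open import Data.List.Relation.Unary.All using (All; []; _∷_)
open import Data.List.Relation.Unary.Unique.Propositional using (Unique)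
open import Data.List.Relation.Unary.Unique.Propositional.Properties using (allFin⁺)
open import Data.List.Relation.Unary.AllPairs using (_∷_)
open import Data.List.Properties using (length-tabulate)
open import Data.Product using (Σ; _×_; _,_; proj₁; proj₂)
open import Data.Sum using (_⊎_; inj₁; inj₂; [_,_]′)
open import Data.Empty using (⊥; ⊥-elim)
open import Data.Unit using (tt)
open import Relation.Nullary using (¬_; Dec; yes; no; does)
open import Relation.Nullary.Decidable using (_→-dec_; _×-dec_; ¬?)
open import Relation.Binary.Definitions using (tri<; tri≈; tri>)
open import Relation.Binary.PropositionalEquality using (_≡_; _≢_; refl; sym; trans; cong; subst; module ≡-Reasoning)

isTrue? : (b : Bool) → Dec (b ≡ true)
isTrue? b = b ≟ᵇ true

¬true→false : ∀ {b} → ¬ (b ≡ true) → b ≡ false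
¬true→false {false} _ = refl
¬true→false {true} h = ⊥-elim (h refl)

false→¬true : ∀ {b} → b ≡ false → ¬ (b ≡ true)
false→¬true refl ()

∧-fst : ∀ {a b} → (a ∧ b) ≡ true → a ≡ true
∧-fst {true} _ = refl

∧-snd : ∀ {a b} → (a ∧ b) ≡ true → b ≡ true
∧-snd {true} h = h

∧-pair : ∀ {a b} → a ≡ true → b ≡ true → (a ∧ b) ≡ true
∧-pair refl refl = refl

∧₃-split : ∀ {a b c} → (a ∧ b ∧ c) ≡ true → a ≡ true × b ≡ true × c ≡ true
∧₃-split {true} {true} {true} _ = refl , refl , refl

∨-cases : ∀ {a b} → (a ∨ b) ≡ true → a ≡ true ⊎ b ≡ true
∨-cases {true} _ = inj₁ refl
∨-cases {false} h = inj₂ h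

∨-left : ∀ {a b} → a ≡ true → (a ∨ b) ≡ true
∨-left refl = refl

∨-right : ∀ {a b} → b ≡ true → (a ∨ b) ≡ true
∨-right {true} _ = refl
∨-right {false} h = h

not-true→false : ∀ {b} → not b ≡ true → b ≡ false
not-true→false {false} _ = refl

not-false→true : ∀ {b} → not b ≡ false → b ≡ true
not-false→true {true} _ = refl

false→not-true : ∀ {b} → b ≡ false → not b ≡ true
false→not-true refl = refl

<ᵇ-sound : ∀ {m k} → (m <ᵇ k) ≡ true → m < k
<ᵇ-sound {m} {k} h = <ᵇ⇒< m k (subst T (sym h) tt)

<ᵇ-complete : ∀ {m k} → m < k → (m <ᵇ k) ≡ true
<ᵇ-complete h = T-true (<⇒<ᵇ h)
  where
    T-true : ∀ {b} → T b → b ≡ true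
    T-true {true} _ = refl

count : ∀ {A : Set} → (A → Bool) → List A → ℕ
count p xs = length (filterᵇ p xs)

count-true : ∀ {A : Set} (p : A → Bool) x xs → p x ≡ true → count p (x ∷ xs) ≡ suc (count p xs)
count-true p x xs e with p x
... | true = refl

count-false : ∀ {A : Set} (p : A → Bool) x xs → p x ≡ false → count p (x ∷ xs) ≡ count p xs
count-false p x xs e with p x
... | false = refl

count-mono : ∀ {A : Set} (p q : A → Bool) → (∀ x → p x ≡ true → q x ≡ true) →
             ∀ xs → count p xs ≤ count q xs
count-mono p q p⇒q [] = z≤n
count-mono p q p⇒q (x ∷ xs) with p x in px | q x in qx
... | true | true = s≤s (count-mono p q p⇒q xs)
... | true | false with () ← trans (sym (p⇒q x px)) qx
... | false | true = ℕₚ.m≤n⇒m≤1+n (count-mono p q p⇒q xs)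
... | false | false = count-mono p q p⇒q xs

count-mono-strict : ∀ {A : Set} (p q : A → Bool) → (∀ x → p x ≡ true → q x ≡ true) →
                    ∀ {w} xs → w ∈ xs → q w ≡ true → p w ≡ false → count p xs < count q xs
count-mono-strict p q p⇒q (x ∷ xs) (here refl) qw pw
  rewrite count-true q x xs qw | count-false p x xs pw = s≤s (count-mono p q p⇒q xs)
count-mono-strict p q p⇒q (x ∷ xs) (there w∈xs) qw pw with p x in px | q x in qx
... | true | true = s≤s (count-mono-strict p q p⇒q xs w∈xs qw pw)
... | true | false with () ← trans (sym (p⇒q x px)) qx
... | false | true = ℕₚ.m≤n⇒m≤1+n (count-mono-strict p q p⇒q xs w∈xs qw pw)
... | false | false = count-mono-strict p q p⇒q xs w∈xs qw pw

count-≤-length : ∀ {A : Set} (p : A → Bool) xs → count p xs ≤ length xs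
count-≤-length p [] = z≤n
count-≤-length p (x ∷ xs) with p x
... | true = s≤s (count-≤-length p xs)
... | false = ℕₚ.m≤n⇒m≤1+n (count-≤-length p xs)

count-all : ∀ {A : Set} (p : A → Bool) → (∀ x → p x ≡ true) → ∀ xs → count p xs ≡ length xs
count-all p all-p [] = refl
count-all p all-p (x ∷ xs) rewrite count-true p x xs (all-p x) = cong suc (count-all p all-p xs)

count-∨ : ∀ {A : Set} (p r : A → Bool) xs → count (λ x → p x ∨ r x) xs ≤ count p xs + count r xs
count-∨ p r [] = z≤n
count-∨ p r (x ∷ xs) with p x | r x
... | true | true = s≤s (≤-trans (count-∨ p r xs) (ℕₚ.+-monoʳ-≤ (count p xs) (ℕₚ.n≤1+n _)))
... | true | false = s≤s (count-∨ p r xs)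
... | false | true = ≤-trans (s≤s (count-∨ p r xs)) (ℕₚ.≤-reflexive (sym (+-suc _ _)))
... | false | false = count-∨ p r xs

count-none : ∀ {A : Set} (r : A → Bool) xs → All (λ y → r y ≡ false) xs → count r xs ≡ 0
count-none r [] [] = refl
count-none r (x ∷ xs) (rx ∷ rxs) rewrite count-false r x xs rx = count-none r xs rxs

count-subsingleton : ∀ {A : Set} (r : A → Bool) → (∀ a b → r a ≡ true → r b ≡ true → a ≡ b) →
                     ∀ xs → Unique xs → count r xs ≤ 1
count-subsingleton r unique [] _ = z≤n
count-subsingleton r unique (x ∷ xs) (x∉xs ∷ u) with r x in rx
... | false = count-subsingleton r unique xs u
... | true = s≤s (ℕₚ.≤-reflexive (count-none r xs (others xs x∉xs)))
  where
    others : ∀ ys → All (x ≢_) ys → All (λ y → r y ≡ false) ys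
    others [] [] = []
    others (y ∷ ys) (x≢y ∷ x≢ys) = ¬true→false (λ ry → x≢y (unique x y rx ry)) ∷ others ys x≢ys

any-witness : ∀ {A : Set} (f : A → Bool) xs → any f xs ≡ true → Σ A λ x → f x ≡ true
any-witness f (x ∷ xs) h with f x in fx
... | true = x , fx
... | false = any-witness f xs h

any-none : ∀ {A : Set} (f : A → Bool) → (∀ x → f x ≡ false) → ∀ xs → any f xs ≡ false
any-none f none [] = refl
any-none f none (x ∷ xs) rewrite none x = any-none f none xs

any-member : ∀ {A : Set} (f : A → Bool) {w} xs → w ∈ xs → f w ≡ true → any f xs ≡ true
any-member f (x ∷ xs) (here refl) fw = ∨-left fw
any-member f (x ∷ xs) (there w∈xs) fw = ∨-right (any-member f xs w∈xs fw)

least : ∀ {n} (P : Fin n → Bool) i → P i ≡ true →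
        Σ (Fin n) λ m → P m ≡ true × (∀ k → toℕ k < toℕ m → P k ≡ false)
least {suc n} P i Pi with P fzero in P0
... | true = fzero , P0 , λ k ()
least {suc n} P fzero Pi | false with () ← trans (sym P0) Pi
least {suc n} P (fsuc i) Pi | false with least (λ k → P (fsuc k)) i Pi
... | m , Pm , below = fsuc m , Pm , below′
  where
    below′ : ∀ k → toℕ k < toℕ (fsuc m) → P k ≡ false
    below′ fzero _ = P0
    below′ (fsuc k) (s≤s k<m) = below k k<m

same-sym : ∀ {n} (R : BRel n) {a b} → SameBlock R a b → SameBlock R b a
same-sym R (ab , ba) = ba , ab

overlap-sym : ∀ {n} (R : BRel n) {i j} → Overlap R i j → Overlap R j i
overlap-sym R (left , right) = right , left

comparable-sym : ∀ {n} (R : BRel n) {i j} → Comparable R i j → Comparable R j i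
comparable-sym R (inj₁ ij) = inj₂ ij
comparable-sym R (inj₂ ji) = inj₁ ji

-- Overlap only refers to blocks, so it survives coarsening the blocks.
overlap-mono : ∀ {n} (R S : BRel n) → (∀ a b → SameBlock R a b → SameBlock S a b) →
               ∀ {i j} → Overlap R i j → Overlap S i j
overlap-mono R S R⊆S ((a , d , ai , dj , a≤d) , (c , b , cj , bi , c≤b)) =
  (a , d , R⊆S _ _ ai , R⊆S _ _ dj , a≤d) , (c , b , R⊆S _ _ cj , R⊆S _ _ bi , c≤b)

module _ {n : ℕ} (R : BRel n) (pre : IsPreorder R) where

  same-refl : ∀ a → SameBlock R a a
  same-refl a = proj₁ pre a , proj₁ pre a

  same-trans : ∀ {a b c} → SameBlock R a b → SameBlock R b c → SameBlock R a c
  same-trans (ab , ba) (bc , cb) = proj₂ pre _ _ _ ab bc , proj₂ pre _ _ _ cb ba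

  lt-trans : ∀ {a b c} → BlockLt R a b → BlockLt R b c → BlockLt R a c
  lt-trans (ab , ¬ba) (bc , ¬cb) = proj₂ pre _ _ _ ab bc , λ ca → ¬cb (proj₂ pre _ _ _ ca ab)

  overlap-respˡ : ∀ {i i' j} → SameBlock R i i' → Overlap R i j → Overlap R i' j
  overlap-respˡ s ((a , d , ai , dj , a≤d) , (c , b , cj , bi , c≤b)) =
    (a , d , same-trans ai s , dj , a≤d) , (c , b , cj , same-trans bi s , c≤b)

  overlap-respʳ : ∀ {i j j'} → SameBlock R j j' → Overlap R i j → Overlap R i j'
  overlap-respʳ s o = overlap-sym R (overlap-respˡ s (overlap-sym R o))

  comparable-respˡ : ∀ {i i' j} → SameBlock R i i' → Comparable R i j → Comparable R i' j
  comparable-respˡ (ii' , i'i) (inj₁ ij) = inj₁ (proj₂ pre _ _ _ i'i ij)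
  comparable-respˡ (ii' , i'i) (inj₂ ji) = inj₂ (proj₂ pre _ _ _ ji ii')

  lt-respˡ : ∀ {i i' j} → SameBlock R i i' → BlockLt R i j → BlockLt R i' j
  lt-respˡ (ii' , i'i) (ij , ¬ji) = proj₂ pre _ _ _ i'i ij , λ ji' → ¬ji (proj₂ pre _ _ _ ji' i'i)

  lt-respʳ : ∀ {i j j'} → SameBlock R j j' → BlockLt R i j → BlockLt R i j'
  lt-respʳ (jj' , j'j) (ij , ¬ji) = proj₂ pre _ _ _ ij jj' , λ j'i → ¬ji (proj₂ pre _ _ _ jj' j'i)

  cover-respˡ : ∀ {i i' j} → SameBlock R i i' → BlockCover R i j → BlockCover R i' j
  cover-respˡ s (lt , tight) = lt-respˡ s lt , λ k (i'k , kj) → tight k (lt-respˡ (same-sym R s) i'k , kj)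

  cover-respʳ : ∀ {i j j'} → SameBlock R j j' → BlockCover R i j → BlockCover R i j'
  cover-respʳ s (lt , tight) = lt-respʳ s lt , λ k (ik , kj') → tight k (ik , lt-respʳ (same-sym R s) kj')

  cover-top : ∀ {a b} → BlockCover R a b → ∀ k → BlockLt R a k → R ∶ k ⪯ b → R ∶ b ⪯ k
  cover-top cv k ak kb with isTrue? (R _ k)
  ... | yes bk = bk
  ... | no ¬bk = ⊥-elim (proj₂ cv k (ak , (kb , ¬bk)))

  cover-bottom : ∀ {a b} → BlockCover R a b → ∀ k → R ∶ a ⪯ k → BlockLt R k b → R ∶ k ⪯ a
  cover-bottom cv k ak kb with isTrue? (R k _)
  ... | yes ka = ka
  ... | no ¬ka = ⊥-elim (proj₂ cv k ((ak , ¬ka) , kb))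

sameBlockᵇ : ∀ {n} → BRel n → Fin n → Fin n → Bool
sameBlockᵇ R a b = R a b ∧ R b a

sameBlockᵇ-sound : ∀ {n} (R : BRel n) a b → sameBlockᵇ R a b ≡ true → SameBlock R a b
sameBlockᵇ-sound R a b h = ∧-fst h , ∧-snd h

sameBlockᵇ-complete : ∀ {n} (R : BRel n) a b → SameBlock R a b → sameBlockᵇ R a b ≡ true
sameBlockᵇ-complete R a b (ab , ba) = ∧-pair ab ba

blockMin-intro : ∀ {n} (R : BRel n) i → (∀ j → toℕ j < toℕ i → ¬ SameBlock R i j) → isBlockMin R i ≡ true
blockMin-intro {n} R i minimal = false→not-true (any-none _ nothing-below (allFin n))
  where
    nothing-below : ∀ j → ((toℕ j <ᵇ toℕ i) ∧ R i j ∧ R j i) ≡ false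
    nothing-below j with (toℕ j <ᵇ toℕ i) in j<i | R i j in ij | R j i in ji
    ... | true | true | true = ⊥-elim (minimal j (<ᵇ-sound j<i) (ij , ji))
    ... | false | _ | _ = refl
    ... | true | false | _ = refl
    ... | true | true | false = refl

blockMin-elim : ∀ {n} (R : BRel n) i j → isBlockMin R i ≡ true → toℕ j < toℕ i → ¬ SameBlock R i j
blockMin-elim {n} R i j min j<i (ij , ji) =
  false→¬true (not-true→false min)
    (any-member _ (allFin n) (∈-allFin j) (∧-pair (<ᵇ-complete j<i) (∧-pair ij ji)))

¬blockMin-witness : ∀ {n} (R : BRel n) i → isBlockMin R i ≡ false →
                    Σ (Fin n) λ j → toℕ j < toℕ i × SameBlock R i j
¬blockMin-witness {n} R i ¬min with any-witness _ (allFin n) (not-false→true ¬min)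
... | j , h with ∧₃-split {toℕ j <ᵇ toℕ i} h
... | j<i , ij , ji = j , <ᵇ-sound j<i , ij , ji

-- Every element lies in the block of a block minimum, namely the least element of its block.
blockMin-of : ∀ {n} (R : BRel n) → IsPreorder R → ∀ i → Σ (Fin n) λ m → isBlockMin R m ≡ true × SameBlock R m i
blockMin-of R pre i with least (λ k → sameBlockᵇ R k i) i (sameBlockᵇ-complete R i i (same-refl R pre i))
... | m , mi , below = m , blockMin-intro R m minimal , sameBlockᵇ-sound R m i mi
  where
    minimal : ∀ j → toℕ j < toℕ m → ¬ SameBlock R m j
    minimal j j<m mj = false→¬true (below j j<m)
      (sameBlockᵇ-complete R j i (same-trans R pre (same-sym R mj) (sameBlockᵇ-sound R m i mi)))

blockMin-unique : ∀ {n} (R : BRel n) a b → isBlockMin R a ≡ true → isBlockMin R b ≡ true →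
                  SameBlock R a b → a ≡ b
blockMin-unique R a b min-a min-b ab with ℕₚ.<-cmp (toℕ a) (toℕ b)
... | tri< a<b _ _ = ⊥-elim (blockMin-elim R b a min-b a<b (same-sym R ab))
... | tri≈ _ a≡b _ = toℕ-injective a≡b
... | tri> _ _ b<a = ⊥-elim (blockMin-elim R a b min-a b<a ab)

blockCount : ∀ {n} → BRel n → ℕ
blockCount {n} R = count (isBlockMin R) (allFin n)

blockCount-≤ : ∀ {n} (R : BRel n) → blockCount R ≤ n
blockCount-≤ {n} R = ≤-trans (count-≤-length (isBlockMin R) (allFin n)) (ℕₚ.≤-reflexive (length-tabulate {n = n} (λ i → i)))

blockMin-refine : ∀ {n} (R R' : BRel n) → (∀ i j → SameBlock R i j → SameBlock R' i j) →
                  ∀ m → isBlockMin R' m ≡ true → isBlockMin R m ≡ true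
blockMin-refine R R' R⊆R' m min' = blockMin-intro R m (λ j j<m mj → blockMin-elim R' m j min' j<m (R⊆R' m j mj))

blockCount-antitone : ∀ {n} (R R' : BRel n) → (∀ i j → SameBlock R i j → SameBlock R' i j) →
                      blockCount R' ≤ blockCount R
blockCount-antitone {n} R R' R⊆R' = count-mono _ _ (blockMin-refine R R' R⊆R') (allFin n)

-- ... and decreases it strictly when two R-blocks are fused: if m' is the R'-minimum
-- of the R'-block of i, some w in that block is not R-equivalent to m', and the
-- R-minimum m of the block of w is an R-minimum but not an R'-minimum.
blockCount-strict : ∀ {n} (R R' : BRel n) → IsPreorder R → IsPreorder R' →
                    (∀ i j → SameBlock R i j → SameBlock R' i j) →
                    ∀ i j → SameBlock R' i j → ¬ SameBlock R i j → blockCount R' < blockCount R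
blockCount-strict {n} R R' pre pre' R⊆R' i j ij' ¬ij =
  count-mono-strict _ _ (blockMin-refine R R' R⊆R') (allFin n) (∈-allFin m) m-min ¬m-min'
  where
    m' : Fin n
    m' = proj₁ (blockMin-of R' pre' i)
    m'-min' : isBlockMin R' m' ≡ true
    m'-min' = proj₁ (proj₂ (blockMin-of R' pre' i))
    m'i : SameBlock R' m' i
    m'i = proj₂ (proj₂ (blockMin-of R' pre' i))
    -- one of i, j lies outside the R-block of m'
    w-far : Σ (Fin n) λ w → SameBlock R' m' w × ¬ SameBlock R m' w
    w-far with isTrue? (sameBlockᵇ R m' i)
    ... | no ¬m'i = i , m'i , λ s → ¬m'i (sameBlockᵇ-complete R m' i s)
    ... | yes m'i-R = j , same-trans R' pre' m'i ij' ,
                      λ m'j → ¬ij (same-trans R pre (same-sym R (sameBlockᵇ-sound R m' i m'i-R)) m'j)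
    w m : Fin n
    w = proj₁ w-far
    m = proj₁ (blockMin-of R pre w)
    m-min : isBlockMin R m ≡ true
    m-min = proj₁ (proj₂ (blockMin-of R pre w))
    mw : SameBlock R m w
    mw = proj₂ (proj₂ (blockMin-of R pre w))
    ¬m-min' : isBlockMin R' m ≡ false
    ¬m-min' = ¬true→false λ min' → proj₂ (proj₂ w-far)
      (subst (λ k → SameBlock R k w) (blockMin-unique R' m m' min' m'-min'
        (same-trans R' pre' (R⊆R' m w mw) (same-sym R' (proj₁ (proj₂ w-far))))) mw)

blockMin-≤ : ∀ {n} (R : BRel n) m j → isBlockMin R m ≡ true → SameBlock R m j → toℕ m ≤ toℕ j
blockMin-≤ R m j min mj with toℕ m ℕₚ.≤? toℕ j
... | yes m≤j = m≤j
... | no m≰j = ⊥-elim (blockMin-elim R m j min (ℕₚ.≰⇒> m≰j) mj)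

-- In a finite pre-order every strict relation i < j is a chain of
-- block covers, so a property of pairs that holds for covers and is closed under
-- composition holds for all strict pairs.  The recursion is on the number of
-- elements strictly between i and j, which drops when the interval is split.

ltᵇ : ∀ {n} → BRel n → Fin n → Fin n → Bool
ltᵇ R i k = R i k ∧ not (R k i)

ltᵇ-complete : ∀ {n} (R : BRel n) {i k} → BlockLt R i k → ltᵇ R i k ≡ true
ltᵇ-complete R (ik , ¬ki) = ∧-pair ik (false→not-true (¬true→false ¬ki))

ltᵇ-sound : ∀ {n} (R : BRel n) {i k} → ltᵇ R i k ≡ true → BlockLt R i k
ltᵇ-sound R {i} {k} h = ∧-fst h , false→¬true (not-true→false (∧-snd {R i k} h))

betweenᵇ : ∀ {n} → BRel n → Fin n → Fin n → Fin n → Bool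
betweenᵇ R i j k = ltᵇ R i k ∧ ltᵇ R k j

betweenᵇ-complete : ∀ {n} (R : BRel n) {i j k} → BlockLt R i k → BlockLt R k j → betweenᵇ R i j k ≡ true
betweenᵇ-complete R ik kj = ∧-pair (ltᵇ-complete R ik) (ltᵇ-complete R kj)

betweenᵇ-sound : ∀ {n} (R : BRel n) {i j k} → betweenᵇ R i j k ≡ true → BlockLt R i k × BlockLt R k j
betweenᵇ-sound R {i} {j} {k} h = ltᵇ-sound R (∧-fst h) , ltᵇ-sound R (∧-snd {ltᵇ R i k} h)

betweenᵇ-endpoints : ∀ {n} (R : BRel n) → IsPreorder R → ∀ i j k → betweenᵇ R i k k ≡ false × betweenᵇ R k j k ≡ false
betweenᵇ-endpoints R pre i j k rewrite proj₁ pre k with ltᵇ R i k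
... | true = refl , refl
... | false = refl , refl

cover-induction : ∀ {n} (R : BRel n) → IsPreorder R → (Q : Fin n → Fin n → Set) →
  (∀ i j → BlockCover R i j → Q i j) →
  (∀ i k j → BlockLt R i k → BlockLt R k j → Q i k → Q k j → Q i j) →
  ∀ i j → BlockLt R i j → Q i j
cover-induction {n} R pre Q base step i₀ j₀ lt₀ = go (suc (gap i₀ j₀)) i₀ j₀ lt₀ ≤-refl
  where
    gap : Fin n → Fin n → ℕ
    gap i j = count (betweenᵇ R i j) (allFin n)

    go : ∀ fuel i j → BlockLt R i j → gap i j < fuel → Q i j
    go (suc fuel) i j ij gap<fuel with any? (λ k → isTrue? (betweenᵇ R i j k))
    ... | no none = base i j (ij , λ k (ik , kj) → none (k , betweenᵇ-complete R ik kj))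
    ... | yes (k , ikj) = step i k j ik kj 
          (go fuel i k ik (shrinks left (proj₁ (betweenᵇ-endpoints R pre i j k))))
          (go fuel k j kj (shrinks right (proj₂ (betweenᵇ-endpoints R pre i j k))))
      where
        ik : BlockLt R i k
        ik = proj₁ (betweenᵇ-sound R ikj)
        kj : BlockLt R k j
        kj = proj₂ (betweenᵇ-sound R ikj)
        left : ∀ k' → betweenᵇ R i k k' ≡ true → betweenᵇ R i j k' ≡ true
        left k' h = betweenᵇ-complete R (proj₁ (betweenᵇ-sound R h)) (lt-trans R pre (proj₂ (betweenᵇ-sound R h)) kj)
        right : ∀ k' → betweenᵇ R k j k' ≡ true → betweenᵇ R i j k' ≡ true
        right k' h = betweenᵇ-complete R (lt-trans R pre ik (proj₁ (betweenᵇ-sound R h))) (proj₂ (betweenᵇ-sound R h))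
        -- both halves omit k itself, which lies strictly between i and j
        shrinks : ∀ {a b} → (∀ k' → betweenᵇ R a b k' ≡ true → betweenᵇ R i j k' ≡ true) →
                  betweenᵇ R a b k ≡ false → gap a b < fuel
        shrinks sub k∉ = <-≤-trans (count-mono-strict _ _ sub (allFin n) (∈-allFin k) ikj k∉) (ℕₚ.≤-pred gap<fuel)

cover-from : ∀ {n} (R : BRel n) → IsPreorder R → ∀ x y → BlockLt R x y →
             Σ (Fin n) λ c → BlockCover R x c × R ∶ c ⪯ y
cover-from {n} R pre = cover-induction R pre (λ x y → Σ (Fin n) λ c → BlockCover R x c × R ∶ c ⪯ y)
  (λ x y x⋖y → y , x⋖y , proj₁ pre y)
  (λ x k y _ ky (c , x⋖c , ck) _ → c , x⋖c , proj₂ pre c k y ck (proj₁ ky))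

-- A strict relation of R' is a chain of R'-covers; each joins
-- overlapping blocks (P2 for R'), which are also R-blocks, hence R-comparable (P1
-- for R), and the comparison cannot go backwards since R ⊆ R'.
rigidity : ∀ {n} (R R' : BRel n) → IsPermPreorder R → IsPermPreorder R' →
           (∀ i j → R ∶ i ⪯ j → R' ∶ i ⪯ j) →
           (∀ i j → SameBlock R' i j → SameBlock R i j) →
           ∀ i j → R' ∶ i ⪯ j → R ∶ i ⪯ j
rigidity R R' (pre , P1 , _) (pre' , _ , P2') R⊆R' same i j ij with isTrue? (R' j i)
... | yes ji = proj₁ (same i j (ij , ji))
... | no ¬ji = cover-induction R' pre' (λ i j → R ∶ i ⪯ j) on-cover (λ i k j _ _ → proj₂ pre i k j) i j (ij , ¬ji)
  where
    on-cover : ∀ i j → BlockCover R' i j → R ∶ i ⪯ j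
    on-cover i j i⋖j with P1 i j (overlap-mono R' R same (P2' i j i⋖j))
    ... | inj₁ ij = ij
    ... | inj₂ ji = ⊥-elim (proj₂ (proj₁ i⋖j) (R⊆R' j i ji))

-- Let R be a permutation pre-order, `down` a down-set and
-- `up` an up-set of R whose intersection is the union of the blocks of x and y
-- ("fused" elements).  Then Z = R ∪ (down × up) is a pre-order whose blocks are
-- those of R, except that the blocks of x and y are fused; Z has at most one block
-- less than R, and Z is a permutation pre-order as soon as P1 and P2 hold for
-- pairs involving the fused block.

module Merge {n : ℕ} (R : BRel n) (perm : IsPermPreorder R)
  (down up : Fin n → Bool) (x y : Fin n)
  (down-closed : ∀ k j → R ∶ k ⪯ j → down j ≡ true → down k ≡ true)
  (up-closed : ∀ j k → R ∶ j ⪯ k → up j ≡ true → up k ≡ true)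
  (x-down : down x ≡ true) (x-up : up x ≡ true) (y-down : down y ≡ true) (y-up : up y ≡ true)
  (fused-blocks : ∀ k → down k ≡ true → up k ≡ true → SameBlock R k x ⊎ SameBlock R k y) where

  pre : IsPreorder R
  pre = proj₁ perm
  trans-R : ∀ i j k → R ∶ i ⪯ j → R ∶ j ⪯ k → R ∶ i ⪯ k
  trans-R = proj₂ pre
  P1 : ∀ i j → Overlap R i j → Comparable R i j
  P1 = proj₁ (proj₂ perm)
  P2 : ∀ i j → BlockCover R i j → Overlap R i j
  P2 = proj₂ (proj₂ perm)

  Z : BRel n
  Z i j = R i j ∨ (down i ∧ up j)

  Fused : Fin n → Set
  Fused k = down k ≡ true × up k ≡ true

  fused? : ∀ k → Dec (Fused k)
  fused? k = isTrue? (down k) ×-dec isTrue? (up k)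

  fused-cases : ∀ k → Fused k → SameBlock R k x ⊎ SameBlock R k y
  fused-cases k (kd , ku) = fused-blocks k kd ku

  Z-ext : ∀ {i j} → R ∶ i ⪯ j → Z ∶ i ⪯ j
  Z-ext h = ∨-left h

  Z-cross : ∀ {i j} → down i ≡ true → up j ≡ true → Z ∶ i ⪯ j
  Z-cross {i} {j} id ju = ∨-right {R i j} (∧-pair id ju)

  Z-cases : ∀ {i j} → Z ∶ i ⪯ j → R ∶ i ⪯ j ⊎ (down i ≡ true × up j ≡ true)
  Z-cases {i} {j} h with ∨-cases {R i j} h
  ... | inj₁ ij = inj₁ ij
  ... | inj₂ cross = inj₂ (∧-fst cross , ∧-snd {down i} cross)

  Z-preorder : IsPreorder Z
  Z-preorder = (λ i → Z-ext (proj₁ pre i)) , Z-trans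
    where
      Z-trans : ∀ i j k → Z ∶ i ⪯ j → Z ∶ j ⪯ k → Z ∶ i ⪯ k
      Z-trans i j k ij jk with Z-cases ij | Z-cases jk
      ... | inj₁ ij | inj₁ jk = Z-ext (trans-R i j k ij jk)
      ... | inj₁ ij | inj₂ (jd , ku) = Z-cross (down-closed i j ij jd) ku
      ... | inj₂ (id , ju) | inj₁ jk = Z-cross id (up-closed j k jk ju)
      ... | inj₂ (id , _) | inj₂ (_ , ku) = Z-cross id ku

  Z-same-cases : ∀ {i j} → SameBlock Z i j → SameBlock R i j ⊎ (Fused i × Fused j)
  Z-same-cases {i} {j} (ij , ji) with Z-cases ij | Z-cases ji
  ... | inj₁ ij | inj₁ ji = inj₁ (ij , ji)
  ... | inj₁ ij | inj₂ (jd , iu) = inj₂ ((down-closed i j ij jd , iu) , (jd , up-closed i j ij iu))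
  ... | inj₂ (id , ju) | inj₁ ji = inj₂ ((id , up-closed j i ji ju) , (down-closed j i ji id , ju))
  ... | inj₂ (id , ju) | inj₂ (jd , iu) = inj₂ ((id , iu) , (jd , ju))

  Z-same⇒R-same : ∀ {a i} → ¬ Fused i → SameBlock Z a i → SameBlock R a i
  Z-same⇒R-same ¬fi s with Z-same-cases s
  ... | inj₁ r = r
  ... | inj₂ (_ , fi) = ⊥-elim (¬fi fi)

  R-same⇒Z-same : ∀ a b → SameBlock R a b → SameBlock Z a b
  R-same⇒Z-same a b (ab , ba) = Z-ext ab , Z-ext ba

  fused⇒Z-same-x : ∀ {i} → Fused i → SameBlock Z i x
  fused⇒Z-same-x (id , iu) = Z-cross id x-up , Z-cross x-down iu

  Z-same-x-cases : ∀ {a} → SameBlock Z a x → SameBlock R a x ⊎ SameBlock R a y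
  Z-same-x-cases s with Z-same-cases s
  ... | inj₁ ax = inj₁ ax
  ... | inj₂ (fa , _) = fused-cases _ fa

  Z-overlap⇒R-overlap : ∀ {i j} → ¬ Fused i → ¬ Fused j → Overlap Z i j → Overlap R i j
  Z-overlap⇒R-overlap ¬fi ¬fj ((a , d , ai , dj , a≤d) , (c , b , cj , bi , c≤b)) =
    (a , d , Z-same⇒R-same ¬fi ai , Z-same⇒R-same ¬fj dj , a≤d) ,
    (c , b , Z-same⇒R-same ¬fj cj , Z-same⇒R-same ¬fi bi , c≤b)

  x-in-fused : SameBlock Z x x
  x-in-fused = same-refl Z Z-preorder x

  y-in-fused : SameBlock Z y x
  y-in-fused = Z-cross y-down x-up , Z-cross x-down y-up

  -- P1 at the fused block, reduced to R: an overlap of the block of an unfused j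
  -- with the block of a fused u, witnessed by a, b ∼ u and c, d ∼ j, makes u and j
  -- R-comparable, hence the fused block and j Z-comparable.
  P1-via : ∀ u j → SameBlock Z u x → ¬ Fused j → ∀ a d c b →
           SameBlock R a u → SameBlock Z d j → toℕ a ≤ toℕ d →
           SameBlock Z c j → SameBlock R b u → toℕ c ≤ toℕ b → Comparable Z x j
  P1-via u j ux ¬fj a d c b au dj a≤d cj bu c≤b
    with P1 u j ((a , d , au , Z-same⇒R-same ¬fj dj , a≤d) , (c , b , Z-same⇒R-same ¬fj cj , bu , c≤b))
  ... | inj₁ uj = comparable-respˡ Z Z-preorder ux (inj₁ (Z-ext uj))
  ... | inj₂ ju = comparable-respˡ Z Z-preorder ux (inj₂ (Z-ext ju))

  Z-lt : ∀ {i k} → BlockLt R i k → (down k ≡ true → up i ≡ true → ⊥) → BlockLt Z i k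
  Z-lt (ik , ¬ki) no-cross = Z-ext ik , λ ki → [ ¬ki , (λ (kd , iu) → no-cross kd iu) ]′ (Z-cases ki)

  -- A Z-cover between unfused elements is an R-cover: a cross relation i ⪯ j would
  -- put the fused block strictly between i and j.
  Z-cover⇒R-cover : ∀ {i j} → ¬ Fused i → ¬ Fused j → BlockCover Z i j → BlockCover R i j
  Z-cover⇒R-cover {i} {j} ¬fi ¬fj ((Zij , ¬Zji) , tight) = (ij , λ ji → ¬Zji (Z-ext ji)) , tight-R
    where
      ij : R ∶ i ⪯ j
      ij with Z-cases Zij
      ... | inj₁ ij = ij
      ... | inj₂ (id , ju) = ⊥-elim (tight x (ix , xj))
        where
          ix : BlockLt Z i x
          ix = Z-cross id x-up ,
               λ xi → [ (λ xi → ¬fi (id , up-closed x i xi x-up)) , (λ c → ¬fi (id , proj₂ c)) ]′ (Z-cases xi)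
          xj : BlockLt Z x j
          xj = Z-cross x-down ju ,
               λ jx → [ (λ jx → ¬fj (down-closed j x jx x-down , ju)) , (λ c → ¬fj (proj₁ c , ju)) ]′ (Z-cases jx)
      tight-R : ∀ k → ¬ (BlockLt R i k × BlockLt R k j)
      tight-R k (ik , kj) = tight k
        ( Z-lt ik (λ kd iu → ¬fi (down-closed i k (proj₁ ik) kd , iu))
        , Z-lt kj (λ jd ku → ¬fj (jd , up-closed k j (proj₁ kj) ku)))

  Z-same-x⇒fused : ∀ {u} → SameBlock Z u x → Fused u
  Z-same-x⇒fused s with Z-same-cases s
  ... | inj₁ (ux , xu) = down-closed _ x ux x-down , up-closed x _ xu x-up
  ... | inj₂ (fu , _) = fu

  above-fused⇒up : ∀ {j} → Z ∶ x ⪯ j → up j ≡ true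
  above-fused⇒up xj = [ (λ xj → up-closed x _ xj x-up) , proj₂ ]′ (Z-cases xj)

  below-fused⇒down : ∀ {j} → Z ∶ j ⪯ x → down j ≡ true
  below-fused⇒down jx = [ (λ jx → down-closed _ x jx x-down) , proj₁ ]′ (Z-cases jx)

  -- P2 at the fused block, reduced to R: if x ⋖ j in Z and u is a fused element with
  -- u ⪯ j in R and nothing of `down` strictly between them, then u ⋖ j in R, and the
  -- overlap given by P2 for R carries over to Z.  Dually for covers below x.
  cover-above-fused : ∀ u j → SameBlock Z u x → ¬ Fused j → BlockCover Z x j → R ∶ u ⪯ j →
                      (∀ k → BlockLt R u k → BlockLt R k j → down k ≡ true → ⊥) → Overlap Z x j
  cover-above-fused u j ux ¬fj x⋖j uj not-down =
    overlap-respˡ Z Z-preorder ux (overlap-mono R Z R-same⇒Z-same (P2 u j ((uj , ¬ju) , tight)))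
    where
      ju-up : up j ≡ true
      ju-up = above-fused⇒up (proj₁ (proj₁ x⋖j))
      ¬ju : ¬ R ∶ j ⪯ u
      ¬ju ju = ¬fj (down-closed j u ju (proj₁ (Z-same-x⇒fused ux)) , ju-up)
      tight : ∀ k → ¬ (BlockLt R u k × BlockLt R k j)
      tight k (uk , kj) = proj₂ x⋖j k
        ( lt-respˡ Z Z-preorder ux (Z-lt uk (λ kd _ → not-down k uk kj kd))
        , Z-lt kj (λ jd _ → ¬fj (jd , ju-up)))

  cover-below-fused : ∀ u j → SameBlock Z u x → ¬ Fused j → BlockCover Z j x → R ∶ j ⪯ u →
                      (∀ k → BlockLt R j k → BlockLt R k u → up k ≡ true → ⊥) → Overlap Z j x
  cover-below-fused u j ux ¬fj j⋖x ju not-up =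
    overlap-respʳ Z Z-preorder ux (overlap-mono R Z R-same⇒Z-same (P2 j u ((ju , ¬uj) , tight)))
    where
      jd-down : down j ≡ true
      jd-down = below-fused⇒down (proj₁ (proj₁ j⋖x))
      ¬uj : ¬ R ∶ u ⪯ j
      ¬uj uj = ¬fj (jd-down , up-closed u j uj (proj₂ (Z-same-x⇒fused ux)))
      tight : ∀ k → ¬ (BlockLt R j k × BlockLt R k u)
      tight k (jk , ku) = proj₂ j⋖x k
        ( Z-lt jk (λ _ ju → ¬fj (jd-down , ju))
        , lt-respʳ Z Z-preorder ux (Z-lt ku (λ _ k-up → not-up k jk ku k-up)))

  P1-at-fused P2-above-fused P2-below-fused : Set
  P1-at-fused = ∀ j → ¬ Fused j → Overlap Z x j → Comparable Z x j
  P2-above-fused = ∀ j → ¬ Fused j → BlockCover Z x j → Overlap Z x j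
  P2-below-fused = ∀ j → ¬ Fused j → BlockCover Z j x → Overlap Z j x

  -- P1 at the fused block when the blocks of x and y overlap in R: the interval of
  -- the fused block is the union of two overlapping intervals, so an interval that
  -- meets it meets one of them.
  P1-from-overlap : Overlap R x y → P1-at-fused
  P1-from-overlap ((a' , d' , a'x , d'y , a'≤d') , (c' , b' , c'y , b'x , c'≤b'))
                  j ¬fj ((a , d , ax , dj , a≤d) , (c , b , cj , bx , c≤b))
    with Z-same-x-cases ax | Z-same-x-cases bx
  ... | inj₁ aX | inj₁ bX = P1-via x j x-in-fused ¬fj a d c b aX dj a≤d cj bX c≤b
  ... | inj₂ aY | inj₂ bY = P1-via y j y-in-fused ¬fj a d c b aY dj a≤d cj bY c≤b
  ... | inj₁ aX | inj₂ bY with toℕ d ℕₚ.≤? toℕ b'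
  ...   | yes d≤b' = P1-via x j x-in-fused ¬fj a d d b' aX dj a≤d dj b'x d≤b'
  ...   | no d≰b' = P1-via y j y-in-fused ¬fj c' d c b c'y dj (≤-trans c'≤b' (ℕₚ.<⇒≤ (ℕₚ.≰⇒> d≰b')))
                                                             cj bY c≤b
  P1-from-overlap ((a' , d' , a'x , d'y , a'≤d') , _) j ¬fj ((a , d , ax , dj , a≤d) , (c , b , cj , bx , c≤b))
    | inj₂ aY | inj₁ bX with toℕ c ℕₚ.≤? toℕ d'
  ...   | yes c≤d' = P1-via y j y-in-fused ¬fj a d c d' aY dj a≤d cj d'y c≤d'
  ...   | no c≰d' = P1-via x j x-in-fused ¬fj a' c c b a'x cj (≤-trans a'≤d' (ℕₚ.<⇒≤ (ℕₚ.≰⇒> c≰d')))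
                                                             cj bX c≤b

  Z-P1 : P1-at-fused → ∀ i j → Overlap Z i j → Comparable Z i j
  Z-P1 at-x i j o with fused? i | fused? j
  ... | yes (id , _) | yes (_ , ju) = inj₁ (Z-cross id ju)
  ... | yes fi | no ¬fj = comparable-respˡ Z Z-preorder (same-sym Z (fused⇒Z-same-x fi))
                            (at-x j ¬fj (overlap-respˡ Z Z-preorder (fused⇒Z-same-x fi) o))
  ... | no ¬fi | yes fj = comparable-sym Z (comparable-respˡ Z Z-preorder (same-sym Z (fused⇒Z-same-x fj))
                            (at-x i ¬fi (overlap-respˡ Z Z-preorder (fused⇒Z-same-x fj) (overlap-sym Z o))))
  ... | no ¬fi | no ¬fj with P1 i j (Z-overlap⇒R-overlap ¬fi ¬fj o)
  ...   | inj₁ ij = inj₁ (Z-ext ij)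
  ...   | inj₂ ji = inj₂ (Z-ext ji)

  Z-P2 : P2-above-fused → P2-below-fused → ∀ i j → BlockCover Z i j → Overlap Z i j
  Z-P2 above below i j i⋖j with fused? i | fused? j
  ... | yes (_ , iu) | yes (jd , _) = ⊥-elim (proj₂ (proj₁ i⋖j) (Z-cross jd iu))
  ... | yes fi | no ¬fj = overlap-respˡ Z Z-preorder (same-sym Z (fused⇒Z-same-x fi))
                            (above j ¬fj (cover-respˡ Z Z-preorder (fused⇒Z-same-x fi) i⋖j))
  ... | no ¬fi | yes fj = overlap-respʳ Z Z-preorder (same-sym Z (fused⇒Z-same-x fj))
                            (below i ¬fi (cover-respʳ Z Z-preorder (fused⇒Z-same-x fj) i⋖j))
  ... | no ¬fi | no ¬fj = overlap-mono R Z R-same⇒Z-same (P2 i j (Z-cover⇒R-cover ¬fi ¬fj i⋖j))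

  Z-perm : P1-at-fused → P2-above-fused → P2-below-fused → IsPermPreorder Z
  Z-perm at-x above below = Z-preorder , Z-P1 at-x , Z-P2 above below

  -- Counting.  A block minimum of R that is not one of Z is "lost"; it is fused, and
  -- since at most one minimum is lost Z has at most one block less than R.
  lost : Fin n → Bool
  lost m = isBlockMin R m ∧ not (isBlockMin Z m)

  lost-witness : ∀ m → lost m ≡ true → isBlockMin R m ≡ true × Fused m ×
                 Σ (Fin n) λ j → toℕ j < toℕ m × Fused j × ¬ SameBlock R m j
  lost-witness m h with ¬blockMin-witness Z m (not-true→false (∧-snd {isBlockMin R m} h))
  ... | j , j<m , mj with Z-same-cases mj
  ...   | inj₁ mj-R = ⊥-elim (blockMin-elim R m j (∧-fst h) j<m mj-R)
  ...   | inj₂ (fm , fj) = ∧-fst h , fm , j , j<m , fj , blockMin-elim R m j (∧-fst h) j<m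

  lost-above-other : ∀ u v → (∀ k → Fused k → SameBlock R k u ⊎ SameBlock R k v) →
                     ∀ m m' → lost m ≡ true → isBlockMin R m' ≡ true →
                     SameBlock R m u → SameBlock R m' v → toℕ m' < toℕ m
  lost-above-other u v blocks m m' lost-m min-m' mu m'v with lost-witness m lost-m
  ... | _ , _ , j , j<m , fj , ¬mj with blocks j fj
  ...   | inj₁ ju = ⊥-elim (¬mj (same-trans R pre mu (same-sym R ju)))
  ...   | inj₂ jv = ℕₚ.≤-<-trans (blockMin-≤ R m' j min-m' (same-trans R pre m'v (same-sym R jv))) j<m

  fused-cases-swapped : ∀ k → Fused k → SameBlock R k y ⊎ SameBlock R k x
  fused-cases-swapped k fk = [ inj₂ , inj₁ ]′ (fused-cases k fk)

  lost-unique : ∀ a b → lost a ≡ true → lost b ≡ true → a ≡ b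
  lost-unique a b lost-a lost-b with lost-witness a lost-a | lost-witness b lost-b
  ... | min-a , fa , _ | min-b , fb , _ with isTrue? (sameBlockᵇ R a b)
  ...   | yes ab = blockMin-unique R a b min-a min-b (sameBlockᵇ-sound R a b ab)
  ...   | no ¬ab with fused-cases a fa | fused-cases b fb
  ...     | inj₁ ax | inj₁ bx = ⊥-elim (¬ab (sameBlockᵇ-complete R a b (same-trans R pre ax (same-sym R bx))))
  ...     | inj₂ ay | inj₂ by = ⊥-elim (¬ab (sameBlockᵇ-complete R a b (same-trans R pre ay (same-sym R by))))
  ...     | inj₁ ax | inj₂ by = ⊥-elim (<-irrefl refl (<-trans (lost-above-other x y fused-cases a b lost-a min-b ax by)
                                                               (lost-above-other y x fused-cases-swapped b a lost-b min-a by ax)))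
  ...     | inj₂ ay | inj₁ bx = ⊥-elim (<-irrefl refl (<-trans (lost-above-other y x fused-cases-swapped a b lost-a min-b ay bx)
                                                               (lost-above-other x y fused-cases b a lost-b min-a bx ay)))

  blockCount-merge : blockCount R ≤ suc (blockCount Z)
  blockCount-merge = begin
    blockCount R                                          ≤⟨ count-mono _ _ kept-or-lost (allFin n) ⟩
    count (λ m → isBlockMin Z m ∨ lost m) (allFin n)      ≤⟨ count-∨ (isBlockMin Z) lost (allFin n) ⟩
    blockCount Z + count lost (allFin n)                  ≤⟨ ℕₚ.+-monoʳ-≤ (blockCount Z) at-most-one ⟩
    blockCount Z + 1                                      ≡⟨ +-comm (blockCount Z) 1 ⟩
    suc (blockCount Z)                                    ∎
    where
      open ℕₚ.≤-Reasoning
      at-most-one : count lost (allFin n) ≤ 1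
      at-most-one = count-subsingleton lost lost-unique (allFin n) (allFin⁺ n)
      kept-or-lost : ∀ m → isBlockMin R m ≡ true → (isBlockMin Z m ∨ lost m) ≡ true
      kept-or-lost m min with isBlockMin Z m
      ... | true = refl
      ... | false rewrite min = refl

-- Case A: fusing the two blocks of a cover c ⋖ d, with down = ↓d and up = ↑c.
-- The fused elements are those between c and d, i.e. the two blocks themselves.

module MergeCover {n : ℕ} (R : BRel n) (perm : IsPermPreorder R) (c d : Fin n) (c⋖d : BlockCover R c d) where

  between-cover : ∀ k → R ∶ k ⪯ d → R ∶ c ⪯ k → SameBlock R k c ⊎ SameBlock R k d
  between-cover k kd ck with isTrue? (R k c) | isTrue? (R d k)
  ... | yes kc | _ = inj₁ (kc , ck)
  ... | no _ | yes dk = inj₂ (kd , dk)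
  ... | no ¬kc | no ¬dk = ⊥-elim (proj₂ c⋖d k ((ck , ¬kc) , (kd , ¬dk)))

  open Merge R perm (λ k → R k d) (λ k → R c k) c d
             (λ k j kj jd → proj₂ (proj₁ perm) k j d kj jd) (λ j k jk cj → proj₂ (proj₁ perm) c j k cj jk)
             (proj₁ (proj₁ c⋖d)) (proj₁ (proj₁ perm) c) (proj₁ (proj₁ perm) d) (proj₁ (proj₁ c⋖d))
             between-cover public

  P2-above : P2-above-fused
  P2-above j ¬fj c⋖j with isTrue? (R d j)
  ... | yes dj = cover-above-fused d j y-in-fused ¬fj c⋖j dj
                   (λ k (_ , ¬kd) _ kd → ¬kd kd)
  ... | no ¬dj = cover-above-fused c j x-in-fused ¬fj c⋖j (above-fused⇒up (proj₁ (proj₁ c⋖j)))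
                   λ k (ck , ¬kc) (kj , _) kd → [ (λ (kc , _) → ¬kc kc) , (λ (_ , dk) → ¬dj (trans-R d k j dk kj)) ]′
                                                   (between-cover k kd ck)

  P2-below : P2-below-fused
  P2-below j ¬fj j⋖c with isTrue? (R j c)
  ... | yes jc = cover-below-fused c j x-in-fused ¬fj j⋖c jc
                   (λ k _ (_ , ¬ck) ck → ¬ck ck)
  ... | no ¬jc = cover-below-fused d j y-in-fused ¬fj j⋖c (below-fused⇒down (proj₁ (proj₁ j⋖c)))
                   λ k (jk , _) (kd , ¬dk) ck → [ (λ (kc , _) → ¬jc (trans-R j k c jk kc)) , (λ (_ , dk) → ¬dk dk) ]′
                                                   (between-cover k kd ck)

  Z-perm-cover : IsPermPreorder Z
  Z-perm-cover = Z-perm (P1-from-overlap (P2 c d c⋖d)) P2-above P2-below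

-- Case B: R ⊆ R', x and y lie in one block of R' but are R-incomparable, x is the
-- least element of that R'-block and y the least element of it not R-equivalent to x.
-- The elements g with x < g < y outside the R'-block of x ("gap" elements) are
-- R'-comparable with x, since their blocks overlap, and are put below or above the
-- fused block accordingly: down = ↓x ∪ ↓y ∪ ↓{gaps below x in R'},
-- up = ↑x ∪ ↑y ∪ ↑{gaps above x in R'}.

module MergeIncomparable {n : ℕ} (R R' : BRel n) (perm : IsPermPreorder R) (perm' : IsPermPreorder R')
  (R⊆R' : ∀ i j → R ∶ i ⪯ j → R' ∶ i ⪯ j) (x y : Fin n)
  (yx' : SameBlock R' y x) (¬xy : ¬ R ∶ x ⪯ y) (¬yx : ¬ R ∶ y ⪯ x) (x<y : toℕ x < toℕ y)
  (x-least : ∀ k → SameBlock R' k x → toℕ x ≤ toℕ k)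
  (below-y : ∀ k → SameBlock R' k x → toℕ k < toℕ y → SameBlock R k x) where

  private
    pre : IsPreorder R
    pre = proj₁ perm
    pre' : IsPreorder R'
    pre' = proj₁ perm'
    trans' : ∀ i j k → R' ∶ i ⪯ j → R' ∶ j ⪯ k → R' ∶ i ⪯ k
    trans' = proj₂ pre'

  Gap : Fin n → Set
  Gap g = toℕ x < toℕ g × toℕ g < toℕ y × ¬ SameBlock R' g x

  gapᵇ : Fin n → Bool
  gapᵇ g = (toℕ x <ᵇ toℕ g) ∧ (toℕ g <ᵇ toℕ y) ∧ not (sameBlockᵇ R' g x)

  gapᵇ-sound : ∀ g → gapᵇ g ≡ true → Gap g
  gapᵇ-sound g h with ∧₃-split {toℕ x <ᵇ toℕ g} h
  ... | x<g , g<y , ¬gx = <ᵇ-sound x<g , <ᵇ-sound g<y ,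
                          λ gx → false→¬true (not-true→false ¬gx) (sameBlockᵇ-complete R' g x gx)

  gapᵇ-complete : ∀ g → Gap g → gapᵇ g ≡ true
  gapᵇ-complete g (x<g , g<y , ¬gx) =
    ∧-pair (<ᵇ-complete x<g)
      (∧-pair (<ᵇ-complete g<y) (false→not-true (¬true→false λ gx → ¬gx (sameBlockᵇ-sound R' g x gx))))

  gap-not-both : ∀ {g} → Gap g → R' ∶ g ⪯ x → R' ∶ x ⪯ g → ⊥
  gap-not-both (_ , _ , ¬gx) gx xg = ¬gx (gx , xg)

  -- A gap element overlaps the R'-block of x, since x < g < y, hence is comparable to x.
  gap-comparable : ∀ {g} → Gap g → R' ∶ g ⪯ x ⊎ R' ∶ x ⪯ g
  gap-comparable {g} (x<g , g<y , _) = proj₁ (proj₂ perm') g x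
    ((g , y , same-refl R' pre' g , yx' , ℕₚ.<⇒≤ g<y) , (x , g , same-refl R' pre' x , same-refl R' pre' g , ℕₚ.<⇒≤ x<g))

  down up : Fin n → Bool
  down i = R i x ∨ R i y ∨ any (λ g → gapᵇ g ∧ R' g x ∧ R i g) (allFin n)
  up j = R x j ∨ R y j ∨ any (λ g → gapᵇ g ∧ R' x g ∧ R g j) (allFin n)

  DownGap UpGap : Fin n → Set
  DownGap i = Σ (Fin n) λ g → Gap g × R' ∶ g ⪯ x × R ∶ i ⪯ g
  UpGap j = Σ (Fin n) λ g → Gap g × R' ∶ x ⪯ g × R ∶ g ⪯ j

  down-cases : ∀ {i} → down i ≡ true → R ∶ i ⪯ x ⊎ R ∶ i ⪯ y ⊎ DownGap i
  down-cases {i} h with ∨-cases {R i x} h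
  ... | inj₁ ix = inj₁ ix
  ... | inj₂ h′ with ∨-cases {R i y} h′
  ...   | inj₁ iy = inj₂ (inj₁ iy)
  ...   | inj₂ h″ with any-witness _ (allFin n) h″
  ...     | g , e with ∧₃-split {gapᵇ g} e
  ...       | G , gx , ig = inj₂ (inj₂ (g , gapᵇ-sound g G , gx , ig))

  up-cases : ∀ {j} → up j ≡ true → R ∶ x ⪯ j ⊎ R ∶ y ⪯ j ⊎ UpGap j
  up-cases {j} h with ∨-cases {R x j} h
  ... | inj₁ xj = inj₁ xj
  ... | inj₂ h′ with ∨-cases {R y j} h′
  ...   | inj₁ yj = inj₂ (inj₁ yj)
  ...   | inj₂ h″ with any-witness _ (allFin n) h″
  ...     | g , e with ∧₃-split {gapᵇ g} e
  ...       | G , xg , gj = inj₂ (inj₂ (g , gapᵇ-sound g G , xg , gj))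

  down-x : ∀ {i} → R ∶ i ⪯ x → down i ≡ true
  down-x ix = ∨-left ix
  down-y : ∀ {i} → R ∶ i ⪯ y → down i ≡ true
  down-y {i} iy = ∨-right {R i x} (∨-left iy)
  down-gap : ∀ {i} → DownGap i → down i ≡ true
  down-gap {i} (g , G , gx , ig) = ∨-right {R i x} (∨-right {R i y}
    (any-member _ (allFin n) (∈-allFin g) (∧-pair (gapᵇ-complete g G) (∧-pair gx ig))))

  up-x : ∀ {j} → R ∶ x ⪯ j → up j ≡ true
  up-x xj = ∨-left xj
  up-y : ∀ {j} → R ∶ y ⪯ j → up j ≡ true
  up-y {j} yj = ∨-right {R x j} (∨-left yj)
  up-gap : ∀ {j} → UpGap j → up j ≡ true
  up-gap {j} (g , G , xg , gj) = ∨-right {R x j} (∨-right {R y j}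
    (any-member _ (allFin n) (∈-allFin g) (∧-pair (gapᵇ-complete g G) (∧-pair xg gj))))

  down⇒below-x : ∀ {i} → down i ≡ true → R' ∶ i ⪯ x
  down⇒below-x {i} h with down-cases h
  ... | inj₁ ix = R⊆R' i x ix
  ... | inj₂ (inj₁ iy) = trans' i y x (R⊆R' i y iy) (proj₁ yx')
  ... | inj₂ (inj₂ (g , _ , gx , ig)) = trans' i g x (R⊆R' i g ig) gx

  up⇒above-x : ∀ {j} → up j ≡ true → R' ∶ x ⪯ j
  up⇒above-x {j} h with up-cases h
  ... | inj₁ xj = R⊆R' x j xj
  ... | inj₂ (inj₁ yj) = trans' x y j (proj₂ yx') (R⊆R' y j yj)
  ... | inj₂ (inj₂ (g , _ , xg , gj)) = trans' x g j xg (R⊆R' g j gj)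

  down-closed : ∀ k j → R ∶ k ⪯ j → down j ≡ true → down k ≡ true
  down-closed k j kj h with down-cases h
  ... | inj₁ jx = down-x (proj₂ pre k j x kj jx)
  ... | inj₂ (inj₁ jy) = down-y (proj₂ pre k j y kj jy)
  ... | inj₂ (inj₂ (g , G , gx , jg)) = down-gap (g , G , gx , proj₂ pre k j g kj jg)

  up-closed : ∀ j k → R ∶ j ⪯ k → up j ≡ true → up k ≡ true
  up-closed j k jk h with up-cases h
  ... | inj₁ xj = up-x (proj₂ pre x j k xj jk)
  ... | inj₂ (inj₁ yj) = up-y (proj₂ pre y j k yj jk)
  ... | inj₂ (inj₂ (g , G , xg , gj)) = up-gap (g , G , xg , proj₂ pre g j k gj jk)

  -- Only the blocks of x and y are both in down and in up: a gap element can be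
  -- neither, and x, y are incomparable.
  fused-blocks : ∀ k → down k ≡ true → up k ≡ true → SameBlock R k x ⊎ SameBlock R k y
  fused-blocks k kd ku with down-cases kd | up-cases ku
  ... | inj₂ (inj₂ (g , G , gx , kg)) | _ = ⊥-elim (gap-not-both G gx (trans' x k g (up⇒above-x ku) (R⊆R' k g kg)))
  ... | _ | inj₂ (inj₂ (g , G , xg , gk)) = ⊥-elim (gap-not-both G (trans' g k x (R⊆R' g k gk) (down⇒below-x kd)) xg)
  ... | inj₁ kx | inj₁ xk = inj₁ (kx , xk)
  ... | inj₁ kx | inj₂ (inj₁ yk) = ⊥-elim (¬yx (proj₂ pre y k x yk kx))
  ... | inj₂ (inj₁ ky) | inj₁ xk = ⊥-elim (¬xy (proj₂ pre x k y xk ky))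
  ... | inj₂ (inj₁ ky) | inj₂ (inj₁ yk) = inj₂ (ky , yk)

  open Merge R perm down up x y down-closed up-closed
             (down-x (proj₁ pre x)) (up-x (proj₁ pre x)) (down-y (proj₁ pre y)) (up-y (proj₁ pre y))
             fused-blocks public hiding (pre)

  Z⊆R' : ∀ i j → Z ∶ i ⪯ j → R' ∶ i ⪯ j
  Z⊆R' i j h with Z-cases h
  ... | inj₁ ij = R⊆R' i j ij
  ... | inj₂ (id , ju) = trans' i x j (down⇒below-x id) (up⇒above-x ju)

  -- An element of down lying R-above some u with x ⪯ u in R' is R-below x or y
  -- (a gap element above it would be R'-above x); dually for up.
  down-above : ∀ {u k} → R' ∶ x ⪯ u → R ∶ u ⪯ k → down k ≡ true → R ∶ k ⪯ x ⊎ R ∶ k ⪯ y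
  down-above {u} {k} xu uk kd with down-cases kd
  ... | inj₁ kx = inj₁ kx
  ... | inj₂ (inj₁ ky) = inj₂ ky
  ... | inj₂ (inj₂ (g , G , gx , kg)) = ⊥-elim (gap-not-both G gx (trans' x u g xu (R⊆R' u g (proj₂ pre u k g uk kg))))

  up-below : ∀ {u k} → R' ∶ u ⪯ x → R ∶ k ⪯ u → up k ≡ true → R ∶ x ⪯ k ⊎ R ∶ y ⪯ k
  up-below {u} {k} ux ku ku-up with up-cases ku-up
  ... | inj₁ xk = inj₁ xk
  ... | inj₂ (inj₁ yk) = inj₂ yk
  ... | inj₂ (inj₂ (g , G , xg , gk)) = ⊥-elim (gap-not-both G (trans' g u x (R⊆R' g u (proj₂ pre g k u gk ku)) ux) xg)

  gap-block-comparable : ∀ g j → Gap g → SameBlock R g j → Comparable Z x j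
  gap-block-comparable g j G (gj , jg) with gap-comparable G
  ... | inj₁ gx = inj₂ (Z-cross (down-closed j g jg (down-gap (g , G , gx , proj₁ pre g))) (up-x (proj₁ pre x)))
  ... | inj₂ xg = inj₁ (Z-cross (down-x (proj₁ pre x)) (up-closed g j gj (up-gap (g , G , xg , proj₁ pre g))))

  gap-above-fused : ∀ {g} → Gap g → R' ∶ x ⪯ g → BlockLt Z x g
  gap-above-fused {g} G xg = Z-cross (down-x (proj₁ pre x)) (up-gap (g , G , xg , proj₁ pre g)) ,
                             λ gx → gap-not-both G (Z⊆R' g x gx) xg

  gap-below-fused : ∀ {g} → Gap g → R' ∶ g ⪯ x → BlockLt Z g x
  gap-below-fused {g} G gx = Z-cross (down-gap (g , G , gx , proj₁ pre g)) (up-x (proj₁ pre x)) ,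
                             λ xg → gap-not-both G gx (Z⊆R' x g xg)

  P2-above : P2-above-fused
  P2-above j ¬fj x⋖j with up-cases (above-fused⇒up (proj₁ (proj₁ x⋖j)))
  ... | inj₁ xj = cover-above-fused x j x-in-fused ¬fj x⋖j xj
        λ k (xk , ¬kx) _ kd → [ ¬kx , (λ ky → ¬xy (proj₂ pre x k y xk ky)) ]′ (down-above (proj₁ pre' x) xk kd)
  ... | inj₂ (inj₁ yj) = cover-above-fused y j y-in-fused ¬fj x⋖j yj
        λ k (yk , ¬ky) _ kd → [ (λ kx → ¬yx (proj₂ pre y k x yk kx)) , ¬ky ]′ (down-above (proj₂ yx') yk kd)
  ... | inj₂ (inj₂ (g , G , xg , gj)) =
        (x , g , x-in-fused , gj-Z , ℕₚ.<⇒≤ (proj₁ G)) , (g , y , gj-Z , y-in-fused , ℕₚ.<⇒≤ (proj₁ (proj₂ G)))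
    where
      gj-Z : SameBlock Z g j
      gj-Z = Z-ext gj , cover-top Z Z-preorder x⋖j g (gap-above-fused G xg) (Z-ext gj)

  P2-below : P2-below-fused
  P2-below j ¬fj j⋖x with down-cases (below-fused⇒down (proj₁ (proj₁ j⋖x)))
  ... | inj₁ jx = cover-below-fused x j x-in-fused ¬fj j⋖x jx
        λ k _ (kx , ¬xk) k-up → [ ¬xk , (λ yk → ¬yx (proj₂ pre y k x yk kx)) ]′ (up-below (proj₁ pre' x) kx k-up)
  ... | inj₂ (inj₁ jy) = cover-below-fused y j y-in-fused ¬fj j⋖x jy
        λ k _ (ky , ¬yk) k-up → [ (λ xk → ¬xy (proj₂ pre x k y xk ky)) , ¬yk ]′ (up-below (proj₁ yx') ky k-up)
  ... | inj₂ (inj₂ (g , G , gx , jg)) =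
        (g , y , gj-Z , y-in-fused , ℕₚ.<⇒≤ (proj₁ (proj₂ G))) , (x , g , x-in-fused , gj-Z , ℕₚ.<⇒≤ (proj₁ G))
    where
      gj-Z : SameBlock Z g j
      gj-Z = cover-bottom Z Z-preorder j⋖x g (Z-ext jg) (gap-below-fused G gx) , Z-ext jg

  -- The block of x lies entirely to the left of the block of y: otherwise the two
  -- blocks would overlap and P1 would make x and y comparable.
  x-block-before-y : ∀ b a → SameBlock R b x → SameBlock R a y → toℕ b < toℕ a
  x-block-before-y b a bx ay with toℕ a ℕₚ.≤? toℕ b
  ... | no a≰b = ℕₚ.≰⇒> a≰b
  ... | yes a≤b = ⊥-elim ([ ¬xy , ¬yx ]′ (P1 x y
          ((x , y , same-refl R pre x , same-refl R pre y , ℕₚ.<⇒≤ x<y) , (a , b , ay , bx , a≤b))))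

  -- Let the interval of a block j meet that of the fused block,
  -- witnessed by a ≤ d and c ≤ b with a, b fused and c, d in the block of j.  If a, b
  -- lie on the same side, or the interval of j reaches y, P1 for R applies to x or y;
  -- otherwise d lies strictly between x and y outside the R'-block of x, i.e. d is a
  -- gap element, and those are comparable with the fused block by construction.
  P1-at : P1-at-fused
  P1-at j ¬fj ((a , d , ax , dj , a≤d) , (c , b , cj , bx , c≤b)) with Z-same-x-cases ax | Z-same-x-cases bx
  ... | inj₁ aX | inj₁ bX = P1-via x j x-in-fused ¬fj a d c b aX dj a≤d cj bX c≤b
  ... | inj₂ aY | inj₂ bY = P1-via y j y-in-fused ¬fj a d c b aY dj a≤d cj bY c≤b
  ... | inj₂ aY | inj₁ bX = P1-via y j y-in-fused ¬fj a d c a aY dj a≤d cj aY c≤a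
    where
      c≤a : toℕ c ≤ toℕ a
      c≤a = ≤-trans c≤b (ℕₚ.<⇒≤ (x-block-before-y b a bX aY))
  ... | inj₁ aX | inj₂ bY with toℕ y ℕₚ.≤? toℕ d
  ...   | yes y≤d = P1-via y j y-in-fused ¬fj y d c b (same-refl R pre y) dj y≤d cj bY c≤b
  ...   | no y≰d = gap-block-comparable d j (x<d , d<y , ¬dx') (Z-same⇒R-same ¬fj dj)
    where
      d<y : toℕ d < toℕ y
      d<y = ℕₚ.≰⇒> y≰d
      -- d cannot be R'-equivalent to x: it would then be R-equivalent to x, and so would j
      ¬dx' : ¬ SameBlock R' d x
      ¬dx' dx' = ¬fj (Z-same-x⇒fused (R-same⇒Z-same j x
                   (same-trans R pre (same-sym R (Z-same⇒R-same ¬fj dj)) (below-y d dx' d<y))))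
      x<d : toℕ x < toℕ d
      x<d with ℕₚ.m≤n⇒m<n∨m≡n (≤-trans (x-least a (R⊆R' a x (proj₁ aX) , R⊆R' x a (proj₂ aX))) a≤d)
      ... | inj₁ x<d = x<d
      ... | inj₂ x≡d = ⊥-elim (¬dx' (subst (λ k → SameBlock R' k x) (toℕ-injective x≡d) (same-refl R' pre' x)))

  Z-perm-incomparable : IsPermPreorder Z
  Z-perm-incomparable = Z-perm P1-at P2-above P2-below

≤S⇒same-mono : ∀ {n} (ω ω' : Ω n) → ω ≤S ω' → ∀ i j → SameBlock (proj₁ ω) i j → SameBlock (proj₁ ω') i j
≤S⇒same-mono ω ω' ω≤ω' i j (ij , ji) = ω≤ω' i j ij , ω≤ω' j i ji

Intermediate : ∀ {n} → Ω n → Ω n → Set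
Intermediate {n} ω ω' = Σ (Ω n) λ ζ → StrictLt _≤S_ ω ζ × ζ ≤S ω' × numBlocks ω ≤ suc (numBlocks ζ)

-- Fusing two blocks of ω inside the ω'-block of x: x is the least element of that
-- block and y the least element of it outside the ω-block of x.  If x and y are
-- comparable in ω we fuse along a cover (case A), otherwise x with y (case B).

module OneMerge {n : ℕ} (ω ω' : Ω n) (ω≤ω' : ω ≤S ω') (x y : Fin n)
  (yx' : SameBlock (proj₁ ω') y x) (¬yx : ¬ SameBlock (proj₁ ω) y x) (x<y : toℕ x < toℕ y)
  (x-least : ∀ k → SameBlock (proj₁ ω') k x → toℕ x ≤ toℕ k)
  (below-y : ∀ k → SameBlock (proj₁ ω') k x → toℕ k < toℕ y → SameBlock (proj₁ ω) k x) where

  private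
    R R' : BRel n
    R = proj₁ ω
    R' = proj₁ ω'
    perm : IsPermPreorder R
    perm = proj₂ ω
    perm' : IsPermPreorder R'
    perm' = proj₂ ω'
    pre : IsPreorder R
    pre = proj₁ perm
    pre' : IsPreorder R'
    pre' = proj₁ perm'

  intermediate : (Z : BRel n) → IsPermPreorder Z → (∀ i j → R ∶ i ⪯ j → Z ∶ i ⪯ j) →
                 ∀ a b → Z ∶ a ⪯ b → ¬ R ∶ a ⪯ b → (∀ i j → Z ∶ i ⪯ j → R' ∶ i ⪯ j) →
                 blockCount R ≤ suc (blockCount Z) → Intermediate ω ω'
  intermediate Z perm-Z R⊆Z a b ab ¬ab Z⊆R' count =
    (Z , perm-Z) , (R⊆Z , λ Z⊆R → ¬ab (Z⊆R a b ab)) , Z⊆R' , count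

  -- Case A: u < v in ω inside the ω'-block of x; fuse u with a block covering it below v.
  via-cover : ∀ u v → BlockLt R u v → SameBlock R' u x → SameBlock R' v x → Intermediate ω ω'
  via-cover u v u<v ux' vx' with cover-from R pre u v u<v
  ... | c , u⋖c , cv = intermediate A.Z A.Z-perm-cover (λ i j → A.Z-ext) c u
                         (A.Z-cross (proj₁ pre c) (proj₁ pre u)) (proj₂ (proj₁ u⋖c)) Z⊆R' A.blockCount-merge
    where
      module A = MergeCover R perm u c u⋖c
      cu' : R' ∶ c ⪯ u
      cu' = proj₂ pre' c v u (ω≤ω' c v cv) (proj₂ pre' v x u (proj₁ vx') (proj₂ ux'))
      Z⊆R' : ∀ i j → A.Z ∶ i ⪯ j → R' ∶ i ⪯ j
      Z⊆R' i j h with A.Z-cases h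
      ... | inj₁ ij = ω≤ω' i j ij
      ... | inj₂ (ic , uj) = proj₂ pre' i c j (ω≤ω' i c ic) (proj₂ pre' c u j cu' (ω≤ω' u j uj))

  one-merge : Intermediate ω ω'
  one-merge with isTrue? (R x y) | isTrue? (R y x)
  ... | yes xy | yes yx = ⊥-elim (¬yx (yx , xy))
  ... | yes xy | no ¬yx = via-cover x y (xy , ¬yx) (same-refl R' pre' x) yx'
  ... | no ¬xy | yes yx = via-cover y x (yx , ¬xy) yx' (same-refl R' pre' x)
  ... | no ¬xy | no ¬yx = intermediate B.Z B.Z-perm-incomparable (λ i j → B.Z-ext) y x
                            (B.Z-cross (B.down-y (proj₁ pre y)) (B.up-x (proj₁ pre x))) ¬yx B.Z⊆R' B.blockCount-merge
    where
      module B = MergeIncomparable R R' perm perm' ω≤ω' x y yx' ¬xy ¬yx x<y x-least below-y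

module StrictPair {n : ℕ} (ω ω' : Ω n) (ω≤ω' : ω ≤S ω') (ω'≰ω : ¬ (ω' ≤S ω)) where

  private
    R R' : BRel n
    R = proj₁ ω
    R' = proj₁ ω'
    perm : IsPermPreorder R
    perm = proj₂ ω
    perm' : IsPermPreorder R'
    perm' = proj₂ ω'
    pre : IsPreorder R
    pre = proj₁ perm
    pre' : IsPreorder R'
    pre' = proj₁ perm'

  -- By rigidity, some block of ω' contains elements in different blocks of ω.
  split : Σ (Fin n) λ i → Σ (Fin n) λ j → SameBlock R' i j × ¬ SameBlock R i j
  split with any? (λ i → any? (λ j → isTrue? (sameBlockᵇ R' i j) ×-dec ¬? (isTrue? (sameBlockᵇ R i j))))
  ... | yes (i , j , ij' , ¬ij) = i , j , sameBlockᵇ-sound R' i j ij' , λ ij → ¬ij (sameBlockᵇ-complete R i j ij)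
  ... | no none = ⊥-elim (ω'≰ω (rigidity R R' perm perm' ω≤ω' same))
    where
      same : ∀ i j → SameBlock R' i j → SameBlock R i j
      same i j ij' with isTrue? (sameBlockᵇ R i j)
      ... | yes ij = sameBlockᵇ-sound R i j ij
      ... | no ¬ij = ⊥-elim (none (i , j , sameBlockᵇ-complete R' i j ij' , ¬ij))

  i₀ j₀ : Fin n
  i₀ = proj₁ split
  j₀ = proj₁ (proj₂ split)
  i₀j₀' : SameBlock R' i₀ j₀
  i₀j₀' = proj₁ (proj₂ (proj₂ split))
  ¬i₀j₀ : ¬ SameBlock R i₀ j₀
  ¬i₀j₀ = proj₂ (proj₂ (proj₂ split))

  blockCount-drop : numBlocks ω' < numBlocks ω
  blockCount-drop = blockCount-strict R R' pre pre' (≤S⇒same-mono ω ω' ω≤ω') i₀ j₀ i₀j₀' ¬i₀j₀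

  x : Fin n
  x = proj₁ (blockMin-of R' pre' i₀)

  xi₀' : SameBlock R' x i₀
  xi₀' = proj₂ (proj₂ (blockMin-of R' pre' i₀))

  x-least : ∀ k → SameBlock R' k x → toℕ x ≤ toℕ k
  x-least k kx = blockMin-≤ R' x k (proj₁ (proj₂ (blockMin-of R' pre' i₀))) (same-sym R' kx)

  far : Fin n → Bool
  far k = sameBlockᵇ R' k x ∧ not (sameBlockᵇ R k x)

  far-complete : ∀ k → SameBlock R' k x → ¬ SameBlock R k x → far k ≡ true
  far-complete k kx' ¬kx = ∧-pair (sameBlockᵇ-complete R' k x kx')
                                  (false→not-true (¬true→false λ kx → ¬kx (sameBlockᵇ-sound R k x kx)))

  some-far : Σ (Fin n) λ w → far w ≡ true
  some-far with isTrue? (sameBlockᵇ R i₀ x)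
  ... | no ¬i₀x = i₀ , far-complete i₀ (same-sym R' xi₀') λ i₀x → ¬i₀x (sameBlockᵇ-complete R i₀ x i₀x)
  ... | yes i₀x = j₀ , far-complete j₀ (same-trans R' pre' (same-sym R' i₀j₀') (same-sym R' xi₀'))
                         λ j₀x → ¬i₀j₀ (same-trans R pre (sameBlockᵇ-sound R i₀ x i₀x) (same-sym R j₀x))

  y : Fin n
  y = proj₁ (least far (proj₁ some-far) (proj₂ some-far))

  yx' : SameBlock R' y x
  yx' = sameBlockᵇ-sound R' y x (∧-fst (proj₁ (proj₂ (least far _ (proj₂ some-far)))))

  ¬yx : ¬ SameBlock R y x
  ¬yx yx = false→¬true (not-true→false (∧-snd {sameBlockᵇ R' y x} (proj₁ (proj₂ (least far _ (proj₂ some-far))))))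
                       (sameBlockᵇ-complete R y x yx)

  below-y : ∀ k → SameBlock R' k x → toℕ k < toℕ y → SameBlock R k x
  below-y k kx' k<y with isTrue? (sameBlockᵇ R k x)
  ... | yes kx = sameBlockᵇ-sound R k x kx
  ... | no ¬kx = ⊥-elim (false→¬true (proj₂ (proj₂ (least far _ (proj₂ some-far))) k k<y)
                           (far-complete k kx' λ kx → ¬kx (sameBlockᵇ-complete R k x kx)))

  x<y : toℕ x < toℕ y
  x<y with ℕₚ.m≤n⇒m<n∨m≡n (x-least y yx')
  ... | inj₁ x<y = x<y
  ... | inj₂ x≡y = ⊥-elim (¬yx (subst (λ k → SameBlock R k x) (toℕ-injective x≡y) (same-refl R pre x)))

  one-merge : Intermediate ω ω'
  one-merge = OneMerge.one-merge ω ω' ω≤ω' x y yx' ¬yx x<y x-least below-y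

-- In a cover ω ⋖ ω' exactly one block is lost: fewer blocks by rigidity, and not two
-- fewer since the one-merge element ζ cannot lie strictly between ω and ω'.
cover-blockCount : ∀ {n} (ω ω' : Ω n) → Covers _≤S_ ω ω' → numBlocks ω ≡ suc (numBlocks ω')
cover-blockCount ω ω' ((ω≤ω' , ω'≰ω) , nothing-between) =
  ℕₚ.≤-antisym (at-most-one-lost one-merge) blockCount-drop
  where
    open StrictPair ω ω' ω≤ω' ω'≰ω using (blockCount-drop; one-merge)
    at-most-one-lost : Intermediate ω ω' → numBlocks ω ≤ suc (numBlocks ω')
    at-most-one-lost (ζ , ω<ζ , ζ≤ω' , ω≤ζ+1) with numBlocks ζ ℕₚ.≤? numBlocks ω'
    ... | yes ζ≤ω' = ≤-trans ω≤ζ+1 (s≤s ζ≤ω')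
    ... | no ζ≰ω' = ⊥-elim (nothing-between ζ (ω<ζ , ζ≤ω' ,
                      λ ω'≤ζ → ζ≰ω' (blockCount-antitone (proj₁ ω') (proj₁ ζ) (≤S⇒same-mono ω' ζ ω'≤ζ))))

discrete : ∀ {n} → BRel n
discrete i j = does (i ≟ j)

discrete-sound : ∀ {n} {i j : Fin n} → discrete ∶ i ⪯ j → i ≡ j
discrete-sound {i = i} {j} h with i ≟ j
... | yes i≡j = i≡j

discrete-refl : ∀ {n} (i : Fin n) → discrete ∶ i ⪯ i
discrete-refl i with i ≟ i
... | yes _ = refl
... | no i≢i = ⊥-elim (i≢i refl)

discrete-perm : ∀ {n} → IsPermPreorder (discrete {n})
discrete-perm = (discrete-refl , transitive) , P1 , P2
  where
    transitive : ∀ i j k → discrete ∶ i ⪯ j → discrete ∶ j ⪯ k → discrete ∶ i ⪯ k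
    transitive i j k ij jk = subst (λ a → discrete ∶ a ⪯ k) (sym (discrete-sound {i = i} {j} ij)) jk
    -- singleton blocks overlap only if they are equal
    P1 : ∀ i j → Overlap discrete i j → Comparable discrete i j
    P1 i j ((a , d , (ai , _) , (dj , _) , a≤d) , (c , b , (cj , _) , (bi , _) , c≤b))
      with discrete-sound {i = a} {i} ai | discrete-sound {i = d} {j} dj | discrete-sound {i = c} {j} cj | discrete-sound {i = b} {i} bi
    ... | refl | refl | refl | refl =
      inj₁ (subst (λ k → discrete ∶ a ⪯ k) (toℕ-injective (ℕₚ.≤-antisym a≤d c≤b)) (discrete-refl a))
    -- there are no strict relations
    P2 : ∀ i j → BlockCover discrete i j → Overlap discrete i j
    P2 i j ((ij , ¬ji) , _) with discrete-sound {i = i} {j} ij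
    ... | refl = ⊥-elim (¬ji (discrete-refl i))

discreteΩ : ∀ {n} → Ω n
discreteΩ = discrete , discrete-perm

discrete-≤S : ∀ {n} (ω : Ω n) → discreteΩ ≤S ω
discrete-≤S ω i j ij = subst (λ k → proj₁ ω ∶ i ⪯ k) (discrete-sound ij) (proj₁ (proj₁ (proj₂ ω)) i)

blockCount-discrete : ∀ {n} (R : BRel n) → (∀ i j → R ∶ i ⪯ j → i ≡ j) → blockCount R ≡ n
blockCount-discrete {n} R trivial =
  trans (count-all (isBlockMin R) all-min (allFin n)) (length-tabulate {n = n} (λ i → i))
  where
    all-min : ∀ m → isBlockMin R m ≡ true
    all-min m = blockMin-intro R m (λ k k<m (mk , _) → <-irrefl (cong toℕ (sym (trivial m k mk))) k<m)

-- A minimal element is discrete, hence has n blocks.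
minimal-blockCount : ∀ {n} (ω : Ω n) → Minimal _≤S_ ω → numBlocks ω ≡ n
minimal-blockCount ω minimal with all? (λ i → all? (λ j → isTrue? (proj₁ ω i j) →-dec isTrue? (discrete i j)))
... | yes ω⊆discrete = blockCount-discrete (proj₁ ω) (λ i j ij → discrete-sound (ω⊆discrete i j ij))
... | no ω⊈discrete = ⊥-elim (minimal discreteΩ (discrete-≤S ω , ω⊈discrete))

∸-step : ∀ n a → a < n → n ∸ a ≡ suc (n ∸ suc a)
∸-step (suc n) zero _ = refl
∸-step (suc n) (suc a) (s≤s a<n) = ∸-step n a a<n

proposition4p1 : ∀ (n : ℕ) → IsGradedBy (_≤S_ {n}) (λ ω → n ∸ numBlocks ω)
proposition4p1 n = minimal-rank , cover-rank
  where
    minimal-rank : ∀ ω → Minimal _≤S_ ω → n ∸ numBlocks ω ≡ 0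
    minimal-rank ω minimal = trans (cong (n ∸_) (minimal-blockCount ω minimal)) (ℕₚ.n∸n≡0 n)

    cover-rank : ∀ ω ω' → Covers _≤S_ ω ω' → n ∸ numBlocks ω' ≡ suc (n ∸ numBlocks ω)
    cover-rank ω ω' ω⋖ω' = begin
      n ∸ numBlocks ω'             ≡⟨ ∸-step n (numBlocks ω') ω'<n ⟩
      suc (n ∸ suc (numBlocks ω')) ≡⟨ cong (λ k → suc (n ∸ k)) (sym one-block-lost) ⟩
      suc (n ∸ numBlocks ω)        ∎
      where
        open ≡-Reasoning
        one-block-lost : numBlocks ω ≡ suc (numBlocks ω')
        one-block-lost = cover-blockCount ω ω' ω⋖ω'
        ω'<n : numBlocks ω' < n
        ω'<n = subst (_≤ n) one-block-lost (blockCount-≤ (proj₁ ω))
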